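{- In the root system of $A_\infty$: if $U\subseteq\Phi^+$ is coclosed, then its closure $\overline{U}$ is biclosed; if $K\subseteq\Phi^+$ is closed, then its interior $K^\circ$ is closed.
   Context: $A_\infty$ is the group of permutations of $\mathbb{Z}$ fixing all but finitely many points. Its positive roots are $\Phi^+=\{\beta_{ij}=e_j-e_i: i<j\}$ in the real vector space with basis $e_i$, $i\in\mathbb{Z}$. A subset $J\subseteq\Phi^+$ is closed if whenever $\alpha,\beta\in J$, $\gamma\in\Phi^+$ and $\gamma\in\mathbb{R}_{>0}\alpha+\mathbb{R}_{>0}\beta$, then $\gamma\in J$ (equivalently, for $i<j<k$, $\beta_{ij},\beta_{jk}\in J$ implies $\beta_{ik}\in J$); coclosed if $\Phi^+\setminus J$ is closed; biclosed if both. $\overline{U}$ is the intersection of all closed sets containing $U$; $K^\circ$ is the union of all coclosed sets contained in $K$. -}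

module Defs where

open import Level using (Level; suc; _⊔_)
open import Data.Integer using (ℤ; _<_)
open import Data.Product using (Σ; _×_)
open import Relation.Nullary using (¬_)

-- A subset of Φ⁺ = { β_ij = e_j - e_i : i < j } is represented by a
-- predicate J on pairs of integers; J i j means β_ij ∈ J.  Only pairs
-- with i < j are ever consulted (all quantifiers below range over i < j).
RSet : (ℓ : Level) → Set (suc ℓ)
RSet ℓ = ℤ → ℤ → Set ℓ

Closed : {ℓ : Level} → RSet ℓ → Set ℓ
Closed J = ∀ {i j k} → i < j → j < k → J i j → J j k → J i k

Compl : {ℓ : Level} → RSet ℓ → RSet ℓ
Compl J i j = ¬ J i j

Coclosed : {ℓ : Level} → RSet ℓ → Set ℓ
Coclosed J = Closed (Compl J)

Biclosed : {ℓ : Level} → RSet ℓ → Set ℓ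
Biclosed J = Closed J × Coclosed J

_⊆Φ_ : {ℓ₁ ℓ₂ : Level} → RSet ℓ₁ → RSet ℓ₂ → Set (ℓ₁ ⊔ ℓ₂)
U ⊆Φ K = ∀ {i j} → i < j → U i j → K i j

closure : {ℓ : Level} → RSet ℓ → RSet (suc ℓ)
closure {ℓ} U i j = (K : RSet ℓ) → Closed K → U ⊆Φ K → K i j

interior : {ℓ : Level} → RSet ℓ → RSet (suc ℓ)
interior {ℓ} K i j = Σ (RSet ℓ) (λ C → Coclosed C × (C ⊆Φ K) × C i j)

-- The closure of U is the set of roots β_ac that are sums of a chain
-- a = x₀ < x₁ < … < xₙ = c of roots of U.  If U is coclosed, such a chain
-- splits at every intermediate b: either b is a vertex of the chain, or it
-- lies inside a step β_{x_m x_{m+1}} ∈ U, which coclosedness splits into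
-- β_{x_m b} or β_{b x_{m+1}} in U.  So the chain set, and with it the closure,
-- is coclosed.  For a closed K, two roots β_ij, β_jk of K° lie in coclosed
-- sets C, D ⊆ K; the chains of C ∪ D form a coclosed set, still inside K by
-- closedness of K, that contains β_ik.
module Submission where

open import Defs
open import Level using (Level)
open import Function using (_∘_)
open import Data.Product using (_×_; _,_; proj₂)
open import Data.Sum using (_⊎_; inj₁; inj₂)
import Data.Sum as Sum
open import Data.Integer using (ℤ; _<_)
open import Data.Integer.Properties using (<-cmp; <-trans)
open import Relation.Binary.Core using (Rel)
open import Relation.Binary.Definitions using (Transitive; tri<; tri≈; tri>)
open import Relation.Binary.Construct.Union using (_∪_)
open import Relation.Binary.Construct.Closure.Transitive
  using (TransClosure; [_]; _∷_; _++_; transitive⁻)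
open import Relation.Binary.PropositionalEquality using (refl)
open import Relation.Nullary.Negation using (¬_; ¬¬-map)

private
  variable
    ℓ ℓ₁ ℓ₂ : Level

Root : RSet ℓ → Rel ℤ ℓ
Root U a b = a < b × U a b

Chain : RSet ℓ → RSet ℓ
Chain U = TransClosure (Root U)

closed⇒transitive : {K : RSet ℓ} → Closed K → Transitive (Root K)
closed⇒transitive cK (ab , Kab) (bc , Kbc) = <-trans ab bc , cK ab bc Kab Kbc

chain-closed : (U : RSet ℓ) → Closed (Chain U)
chain-closed U _ _ = _++_

chain-minimal : {U K : RSet ℓ} → Closed K → U ⊆Φ K → Chain U ⊆Φ K
chain-minimal {U = U} {K} cK U⊆K _ =
  proj₂ ∘ transitive⁻ (Root K) (closed⇒transitive cK) ∘ toK
  where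
  toK : ∀ {a b} → Chain U a b → Chain K a b
  toK [ ab , u ]      = [ ab , U⊆K ab u ]
  toK ((ab , u) ∷ bc) = (ab , U⊆K ab u) ∷ toK bc

root-split : {U : RSet ℓ} → Coclosed U → ∀ {a b c} → a < b → b < c →
             U a c → ¬ ¬ (Chain U a b ⊎ Chain U b c)
root-split cU ab bc u k = cU ab bc (k ∘ inj₁ ∘ [_] ∘ (ab ,_)) (k ∘ inj₂ ∘ [_] ∘ (bc ,_)) u

chain-split : {U : RSet ℓ} → Coclosed U → ∀ {a b c} → a < b → b < c →
              Chain U a c → ¬ ¬ (Chain U a b ⊎ Chain U b c)
chain-split cU ab bc [ _ , u ] = root-split cU ab bc u
chain-split cU {b = b} ab bc ((ax , u) ∷ xc) with <-cmp b _
... | tri< bx _ _  = ¬¬-map (Sum.map₂ (_++ xc)) (root-split cU ab bx u)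
... | tri≈ _ refl _ = λ k → k (inj₁ [ ax , u ])
... | tri> _ _ xb  = ¬¬-map (Sum.map₁ ((ax , u) ∷_)) (chain-split cU xb bc xc)

chain-coclosed : {U : RSet ℓ} → Coclosed U → Coclosed (Chain U)
chain-coclosed cU ab bc ¬ac₁ ¬ac₂ ac =
  chain-split cU ab bc ac (Sum.[ ¬ac₁ , ¬ac₂ ])

closure⊆chain : (U : RSet ℓ) → closure U ⊆Φ Chain U
closure⊆chain U _ Ū = Ū (Chain U) (chain-closed U) (λ ab u → [ ab , u ])

chain⊆closure : (U : RSet ℓ) → Chain U ⊆Φ closure U
chain⊆closure U ab c K cK U⊆K = chain-minimal cK U⊆K ab c

closure-closed : (U : RSet ℓ) → Closed (closure U)
closure-closed U ab bc Ūab Ūbc K cK U⊆K = cK ab bc (Ūab K cK U⊆K) (Ūbc K cK U⊆K)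

coclosed-resp : {A : RSet ℓ₁} {B : RSet ℓ₂} →
                A ⊆Φ B → B ⊆Φ A → Coclosed A → Coclosed B
coclosed-resp A⊆B B⊆A cA ab bc ¬Bab ¬Bbc Bac =
  cA ab bc (¬Bab ∘ A⊆B ab) (¬Bbc ∘ A⊆B bc) (B⊆A (<-trans ab bc) Bac)

∪-coclosed : {C D : RSet ℓ} → Coclosed C → Coclosed D → Coclosed (C ∪ D)
∪-coclosed cC cD ab bc ¬ab ¬bc (inj₁ c) = cC ab bc (¬ab ∘ inj₁) (¬bc ∘ inj₁) c
∪-coclosed cC cD ab bc ¬ab ¬bc (inj₂ d) = cD ab bc (¬ab ∘ inj₂) (¬bc ∘ inj₂) d

∪-⊆Φ : {C D K : RSet ℓ} → C ⊆Φ K → D ⊆Φ K → (C ∪ D) ⊆Φ K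
∪-⊆Φ C⊆K D⊆K ab = Sum.[ C⊆K ab , D⊆K ab ]

closure-biclosed : (U : RSet ℓ) → Coclosed U → Biclosed (closure U)
closure-biclosed U cU =
  closure-closed U ,
  coclosed-resp (chain⊆closure U) (closure⊆chain U) (chain-coclosed cU)

interior-closed : (K : RSet ℓ) → Closed K → Closed (interior K)
interior-closed K cK ij jk (C , cC , C⊆K , c) (D , cD , D⊆K , d) =
  Chain (C ∪ D) ,
  chain-coclosed (∪-coclosed cC cD) ,
  chain-minimal cK (∪-⊆Φ C⊆K D⊆K) ,
  (ij , inj₁ c) ∷ [ jk , inj₂ d ]

lemma5p2 : {ℓ : Level}
    → ((U : RSet ℓ) → Coclosed U → Biclosed (closure U))
      × ((K : RSet ℓ) → Closed K → Closed (interior K))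
lemma5p2 = closure-biclosed , interior-closed
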